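{- Let $\mathcal{G}$ be a hereditary graph class containing $K_2$. Then for every bipartite graph $B$, $c^{\mathcal{G}}_{\mathrm u}(B)\le\bigl(c^{\mathcal{G}}_{\mathrm f}(B)\bigr)^2$.
   Context: All graphs are finite and simple. A class is hereditary if closed under induced subgraphs. For graphs $G,H$, a homomorphism $\varphi\colon G\to H$ is a map $V(G)\to V(H)$ with $\varphi(u)\varphi(v)\in E(H)$ whenever $uv\in E(G)$. $\dot\cup$ denotes vertex-disjoint union. For a graph class $\mathcal{G}$ and a graph $H$, a $\mathcal{G}$-cover of $H$ is an edge-surjective homomorphism $\varphi\colon G_1\dot\cup\cdots\dot\cup G_t\to H$ with all $G_i\in\mathcal{G}$; it is called $t$-global, injective if each $\varphi|_{G_i}$ is injective, and $s$-local if $|\varphi^{ -1}(v)|\le s$ for all $v\in V(H)$. $\overline{\mathcal{G}}$ is the class of all vertex-disjoint unions of graphs in $\mathcal{G}$. $c^{\mathcal{G}}_{\mathrm u}(H)$ is the least $t$ such that $H$ has a $t$-global injective $\overline{\mathcal{G}}$-cover; $c^{\mathcal{G}}_{\mathrm f}(H)$ the least $s$ such that $H$ has an $s$-local (not necessarily injective) $\mathcal{G}$-cover. -}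

module Defs where

open import Data.Nat using (ℕ; _≤_)
open import Data.Bool using (Bool; true; false)
open import Data.Fin using (Fin; zero; suc; _≟_)
open import Data.List using (List; map; length; filter; allFin)
open import Data.Nat.ListAction using (sum)
open import Data.Product using (Σ; ∃; _×_; _,_; proj₁)
open import Relation.Binary.PropositionalEquality using (_≡_; refl)
open import Function.Definitions using (Injective)

record Graph : Set where
  field
    n      : ℕ
    adj    : Fin n → Fin n → Bool
    sym    : ∀ x y → adj x y ≡ adj y x
    irrefl : ∀ x → adj x x ≡ false
open Graph public

V : Graph → Set
V G = Fin (n G)

Edge : (G : Graph) → V G → V G → Set
Edge G x y = adj G x y ≡ true

Hom : Graph → Graph → Set
Hom G H = Σ (V G → V H) λ f → ∀ x y → Edge G x y → Edge H (f x) (f y)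

InducedEmb : Graph → Graph → Set
InducedEmb H G = Σ (V H → V G) λ f →
  Injective _≡_ _≡_ f × (∀ x y → adj G (f x) (f y) ≡ adj H x y)

GraphClass : Set₁
GraphClass = Graph → Set

Hereditary : GraphClass → Set
Hereditary 𝒢 = ∀ G H → InducedEmb H G → 𝒢 G → 𝒢 H

K2adj : Fin 2 → Fin 2 → Bool
K2adj zero zero = false
K2adj zero (suc zero) = true
K2adj (suc zero) zero = true
K2adj (suc zero) (suc zero) = false

K2sym : ∀ x y → K2adj x y ≡ K2adj y x
K2sym zero zero = refl
K2sym zero (suc zero) = refl
K2sym (suc zero) zero = refl
K2sym (suc zero) (suc zero) = refl

K2irr : ∀ x → K2adj x x ≡ false
K2irr zero = refl
K2irr (suc zero) = refl

K2 : Graph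
K2 = record { n = 2 ; adj = K2adj ; sym = K2sym ; irrefl = K2irr }

Bipartite : Graph → Set
Bipartite G = Σ (V G → Bool) λ c → ∀ x y → Edge G x y → c x ≡ c y → Data.Empty.⊥
  where import Data.Empty

preimageSize : (G : Graph) {m : ℕ} → (V G → Fin m) → Fin m → ℕ
preimageSize G f v = length (filter (λ x → f x ≟ v) (allFin (n G)))

-- An s-local 𝒢-cover of H:  an edge-surjective homomorphism
-- φ : G₁ ∪̇ … ∪̇ G_t → H with all G_i ∈ 𝒢 (a homomorphism out of a disjoint
-- union is a family of homomorphisms φ_i : G_i → H), with |φ⁻¹(v)| ≤ s.
record LocalCover (𝒢 : GraphClass) (H : Graph) (s : ℕ) : Set where
  field
    t     : ℕ
    G     : Fin t → Graph
    inG   : ∀ i → 𝒢 (G i)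
    φ     : ∀ i → Hom (G i) H
    surj  : ∀ u v → Edge H u v →
            Σ (Fin t) λ i → Σ (V (G i)) λ x → Σ (V (G i)) λ y →
              Edge (G i) x y × (proj₁ (φ i) x ≡ u) × (proj₁ (φ i) y ≡ v)
    local : ∀ v → sum (map (λ i → preimageSize (G i) (proj₁ (φ i)) v) (allFin t)) ≤ s

-- A t-global injective 𝒢̄-cover of H: components C₁,…,C_t, each C_i ∈ 𝒢̄,
-- i.e. C_i = G_{i,1} ∪̇ … ∪̇ G_{i,k_i} with all G_{i,j} ∈ 𝒢 (k_i = 0 allowed),
-- together with an edge-surjective homomorphism whose restriction to each
-- C_i is injective.  A homomorphism out of C_i is a family of homomorphisms
-- φ_{i,j} : G_{i,j} → H; injectivity on C_i is joint injectivity on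
-- the vertex set Σ j, V(G_{i,j}).
record GlobalInjCover (𝒢 : GraphClass) (H : Graph) (t : ℕ) : Set where
  field
    k     : Fin t → ℕ
    G     : (i : Fin t) → Fin (k i) → Graph
    inG   : ∀ i j → 𝒢 (G i j)
    φ     : ∀ i j → Hom (G i j) H
    inj   : ∀ i j x j′ x′ → proj₁ (φ i j) x ≡ proj₁ (φ i j′) x′ →
            _≡_ {A = Σ (Fin (k i)) λ j → V (G i j)} (j , x) (j′ , x′)
    surj  : ∀ u v → Edge H u v →
            Σ (Fin t) λ i → Σ (Fin (k i)) λ j →
            Σ (V (G i j)) λ x → Σ (V (G i j)) λ y →
              Edge (G i j) x y × (proj₁ (φ i j) x ≡ u) × (proj₁ (φ i j) y ≡ v)

IsLeast : (ℕ → Set) → ℕ → Set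
IsLeast P m = P m × (∀ m′ → P m′ → m ≤ m′)

-- c_u^𝒢(H) ≡ c  and  c_f^𝒢(H) ≡ c, as relations.
IsCu : GraphClass → Graph → ℕ → Set
IsCu 𝒢 H = IsLeast (GlobalInjCover 𝒢 H)

IsCf : GraphClass → Graph → ℕ → Set
IsCf 𝒢 H = IsLeast (LocalCover 𝒢 H)

{-# OPTIONS --safe #-}
module Submission where

-- Take an s-local cover of a bipartite graph B.  Each vertex of B has at most s
-- preimages, so the preimages can be coloured with s colours, injectively on
-- every fibre.  For each pair of colours (a , b), restrict every cover graph to
-- the vertices of colour a lying over the first side of B and colour b lying
-- over the second side.  Hereditarity keeps these restrictions in the class, a
-- fibre meets each of them at most once, and an edge of B whose lift has
-- endpoints coloured a and b survives in the restriction for (a , b).  These s²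
-- unions of restricted graphs form an injective global cover.

open import Defs hiding (sym)
open import Level using (0ℓ)
open import Data.Bool using (Bool; true; false; if_then_else_)
open import Data.Nat using (ℕ; _≤_; _*_; _+_)
open import Data.Fin using (Fin; zero; suc; toℕ; inject≤; _≟_; combine; remQuot)
open import Data.Fin.Properties using (toℕ-injective; toℕ-inject≤; remQuot-combine)
open import Data.List using (List; []; _∷_; map; concatMap; length; lookup; filter; allFin)
open import Data.List.Properties using (length-++; length-map; map-cong)
open import Data.Nat.ListAction using (sum)
open import Data.List.Membership.Propositional using (_∈_)
open import Data.List.Membership.Propositional.Properties
  using (∈-lookup; ∈-allFin; ∈-filter⁺; ∈-filter⁻; ∈-map⁺; ∈-concat⁺′)
open import Data.List.Membership.Setoid.Properties using (index-injective)
open import Data.List.Relation.Unary.Any using (index)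
open import Data.List.Relation.Unary.Any.Properties using (lookup-index)
import Data.List.Relation.Unary.All as All
open import Data.List.Relation.Unary.AllPairs using (_∷_)
open import Data.List.Relation.Unary.Unique.Propositional using (Unique)
open import Data.List.Relation.Unary.Unique.Propositional.Properties using (allFin⁺; filter⁺)
open import Data.Product using (Σ; ∃; ∃₂; _×_; _,_; proj₁; proj₂)
open import Data.Product.Properties using (Σ-≡,≡←≡)
open import Data.Empty using (⊥-elim)
open import Function using (_∘_)
open import Function.Definitions using (Injective)
open import Relation.Unary using (Pred; Decidable)
open import Relation.Binary.PropositionalEquality
  using (_≡_; _≢_; refl; sym; trans; cong; subst; subst₂; setoid; module ≡-Reasoning)

lookup-injective : {A : Set} {xs : List A} → Unique xs → Injective _≡_ _≡_ (lookup xs)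
lookup-injective {xs = _ ∷ _} _            {zero}  {zero}  _  = refl
lookup-injective {xs = _ ∷ _} (x∉xs ∷ _)   {zero}  {suc j} eq =
  ⊥-elim (All.lookup x∉xs (∈-lookup j) eq)
lookup-injective {xs = _ ∷ _} (x∉xs ∷ _)   {suc i} {zero}  eq =
  ⊥-elim (All.lookup x∉xs (∈-lookup i) (sym eq))
lookup-injective {xs = _ ∷ _} (_ ∷ unique) {suc i} {suc j} eq =
  cong suc (lookup-injective unique eq)

length-concatMap : {A B : Set} (f : A → List B) (xs : List A) →
                   length (concatMap f xs) ≡ sum (map (length ∘ f) xs)
length-concatMap f []       = refl
length-concatMap f (x ∷ xs) = trans (length-++ (f x)) (cong (length (f x) +_) (length-concatMap f xs))

Σ-map₂-injective : {A : Set} {B C : A → Set} {f : ∀ a → B a → C a} →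
                   (∀ a → Injective _≡_ _≡_ (f a)) →
                   ∀ {a a′ b b′} → _≡_ {A = Σ A C} (a , f a b) (a′ , f a′ b′) →
                   _≡_ {A = Σ A B} (a , b) (a′ , b′)
Σ-map₂-injective f-injective eq with Σ-≡,≡←≡ eq
... | refl , fb≡fb′ = cong (_ ,_) (f-injective _ fb≡fb′)

module Induced (G : Graph) {P : Pred (V G) 0ℓ} (P? : Decidable P) where

  members : List (V G)
  members = filter P? (allFin (n G))

  inclusion : Fin (length members) → V G
  inclusion = lookup members

  induced : Graph
  induced = record
    { n      = length members
    ; adj    = λ x y → adj G (inclusion x) (inclusion y)
    ; sym    = λ x y → Graph.sym G (inclusion x) (inclusion y)
    ; irrefl = λ x → irrefl G (inclusion x)
    }

  inclusion-injective : Injective _≡_ _≡_ inclusion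
  inclusion-injective = lookup-injective (filter⁺ P? (allFin⁺ (n G)))

  induced-embedding : InducedEmb induced G
  induced-embedding = inclusion , inclusion-injective , λ _ _ → refl

  inclusion-satisfies : ∀ x → P (inclusion x)
  inclusion-satisfies x = proj₂ (∈-filter⁻ P? {xs = allFin (n G)} (∈-lookup x))

  inclusion-onto : ∀ {v} → P v → ∃ λ x → inclusion x ≡ v
  inclusion-onto {v} Pv = index v∈members , sym (lookup-index v∈members)
    where
    v∈members : v ∈ members
    v∈members = ∈-filter⁺ P? (∈-allFin v) Pv

  restrict : ∀ {H} → Hom G H → Hom induced H
  restrict (f , f-hom) = f ∘ inclusion , λ x y → f-hom (inclusion x) (inclusion y)

  induced-edge : ∀ {u v} → Edge G u v → P u → P v →
                 ∃₂ λ x y → Edge induced x y × inclusion x ≡ u × inclusion y ≡ v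
  induced-edge uv Pu Pv with inclusion-onto Pu | inclusion-onto Pv
  ... | x , refl | y , refl = x , y , uv , refl , refl

module FibreColouring {X Y : Set} (π : X → Y) (fibre : Y → List X)
                      (∈-fibre : ∀ p → p ∈ fibre (π p))
                      {s : ℕ} (fibre-bounded : ∀ y → length (fibre y) ≤ s) where

  colour : X → Fin s
  colour p = inject≤ (index (∈-fibre p)) (fibre-bounded (π p))

  colour-injective-on-fibres : ∀ {p q} → π p ≡ π q → colour p ≡ colour q → p ≡ q
  colour-injective-on-fibres {p} {q} πp≡πq cp≡cq =
    position-injective πp≡πq (∈-fibre p) (∈-fibre q) (begin
      toℕ (index (∈-fibre p)) ≡⟨ sym (toℕ-inject≤ _ _) ⟩
      toℕ (colour p)          ≡⟨ cong toℕ cp≡cq ⟩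
      toℕ (colour q)          ≡⟨ toℕ-inject≤ _ _ ⟩
      toℕ (index (∈-fibre q)) ∎)
    where
    open ≡-Reasoning
    position-injective : ∀ {y z} → y ≡ z → (p∈ : p ∈ fibre y) (q∈ : q ∈ fibre z) →
                         toℕ (index p∈) ≡ toℕ (index q∈) → p ≡ q
    position-injective refl p∈ q∈ eq = index-injective (setoid X) p∈ q∈ (toℕ-injective eq)

module LocalCoverFibres {𝒢 : GraphClass} {H : Graph} {s : ℕ} (L : LocalCover 𝒢 H s) where
  open LocalCover L

  CoverVertex : Set
  CoverVertex = Σ (Fin t) λ i → V (G i)

  π : CoverVertex → V H
  π (i , x) = proj₁ (φ i) x

  fibreIn : V H → (i : Fin t) → List CoverVertex
  fibreIn v i = map (i ,_) (filter (λ x → proj₁ (φ i) x ≟ v) (allFin (n (G i))))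

  fibre : V H → List CoverVertex
  fibre v = concatMap (fibreIn v) (allFin t)

  ∈-fibre : ∀ p → p ∈ fibre (π p)
  ∈-fibre (i , x) =
    ∈-concat⁺′ (∈-map⁺ (i ,_) (∈-filter⁺ (λ y → proj₁ (φ i) y ≟ π (i , x)) (∈-allFin x) refl))
               (∈-map⁺ (fibreIn (π (i , x))) (∈-allFin i))

  fibre-bounded : ∀ v → length (fibre v) ≤ s
  fibre-bounded v = subst (_≤ s) (sym length-fibre) (local v)
    where
    open ≡-Reasoning
    length-fibre : length (fibre v) ≡ sum (map (λ i → preimageSize (G i) (proj₁ (φ i)) v) (allFin t))
    length-fibre = begin
      length (fibre v)                            ≡⟨ length-concatMap (fibreIn v) (allFin t) ⟩
      sum (map (length ∘ fibreIn v) (allFin t))   ≡⟨ cong sum (map-cong length-fibreIn (allFin t)) ⟩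
      sum (map (λ i → preimageSize (G i) (proj₁ (φ i)) v) (allFin t)) ∎
      where
      length-fibreIn : ∀ i → length (fibreIn v i) ≡ preimageSize (G i) (proj₁ (φ i)) v
      length-fibreIn i = length-map {B = CoverVertex} (i ,_) (filter (λ x → proj₁ (φ i) x ≟ v) (allFin (n (G i))))

  open FibreColouring π fibre ∈-fibre fibre-bounded public

module ColourSplit {𝒢 : GraphClass} {H : Graph} (bipartite : Bipartite H)
                   {s : ℕ} (L : LocalCover 𝒢 H s) where
  open LocalCover L
  open LocalCoverFibres L

  side : V H → Bool
  side = proj₁ bipartite

  target : Fin (s * s) → Bool → Fin s
  target r c = if c then proj₁ (remQuot {s} s r) else proj₂ (remQuot {s} s r)

  Kept : Fin (s * s) → Pred CoverVertex 0ℓ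
  Kept r p = colour p ≡ target r (side (π p))

  kept? : ∀ r → Decidable (Kept r)
  kept? r p = colour p ≟ target r (side (π p))

  module Component (r : Fin (s * s)) (i : Fin t) = Induced (G i) (λ x → kept? r (i , x))

  component : Fin (s * s) → Fin t → Graph
  component = Component.induced

  component-injective : ∀ r {i j x y} →
    proj₁ (φ i) (Component.inclusion r i x) ≡ proj₁ (φ j) (Component.inclusion r j y) →
    _≡_ {A = Σ (Fin t) (V ∘ component r)} (i , x) (j , y)
  component-injective r {i} {j} {x} {y} same-image =
    Σ-map₂-injective (Component.inclusion-injective r)
      (colour-injective-on-fibres same-image (begin
        colour (i , Component.inclusion r i x)              ≡⟨ Component.inclusion-satisfies r i x ⟩
        target r (side (π (i , Component.inclusion r i x))) ≡⟨ cong (target r ∘ side) same-image ⟩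
        target r (side (π (j , Component.inclusion r j y))) ≡⟨ sym (Component.inclusion-satisfies r j y) ⟩
        colour (j , Component.inclusion r j y)              ∎))
    where open ≡-Reasoning

  kept-across-edge : ∀ p q → side (π p) ≢ side (π q) →
                     ∃ λ r → colour p ≡ target r (side (π p)) × colour q ≡ target r (side (π q))
  kept-across-edge p q sides-differ with side (π p) | side (π q)
  ... | true  | true  = ⊥-elim (sides-differ refl)
  ... | false | false = ⊥-elim (sides-differ refl)
  ... | true  | false = combine (colour p) (colour q) ,
                        sym (cong proj₁ (remQuot-combine (colour p) (colour q))) ,
                        sym (cong proj₂ (remQuot-combine (colour p) (colour q)))
  ... | false | true  = combine (colour q) (colour p) ,
                        sym (cong proj₂ (remQuot-combine (colour q) (colour p))) ,
                        sym (cong proj₁ (remQuot-combine (colour q) (colour p)))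

  components-cover : ∀ u v → Edge H u v →
    Σ (Fin (s * s)) λ r → Σ (Fin t) λ i → Σ (V (component r i)) λ x → Σ (V (component r i)) λ y →
      Edge (component r i) x y ×
      proj₁ (φ i) (Component.inclusion r i x) ≡ u × proj₁ (φ i) (Component.inclusion r i y) ≡ v
  components-cover u v uv =
    let i , x , y , xy , x↦u , y↦v = surj u v uv
        r , x-kept , y-kept = kept-across-edge (i , x) (i , y)
          (subst₂ (λ a b → side a ≢ side b) (sym x↦u) (sym y↦v) (proj₂ bipartite u v uv))
        x′ , y′ , x′y′ , x′↦x , y′↦y = Component.induced-edge r i xy x-kept y-kept
    in r , i , x′ , y′ , x′y′ , trans (cong (proj₁ (φ i)) x′↦x) x↦u , trans (cong (proj₁ (φ i)) y′↦y) y↦v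

  globalInjCover : Hereditary 𝒢 → GlobalInjCover 𝒢 H (s * s)
  globalInjCover hereditary = record
    { k    = λ _ → t
    ; G    = component
    ; inG  = λ r i → hereditary (G i) (component r i) (Component.induced-embedding r i) (inG i)
    ; φ    = λ r i → Component.restrict r i {H} (φ i)
    ; inj  = λ r _ _ _ _ → component-injective r
    ; surj = components-cover
    }

-- K₂ ∈ 𝒢 only ensures that the two cover numbers exist; here they are given.
lemma14 : (𝒢 : GraphClass) → Hereditary 𝒢 → 𝒢 K2 →
    (B : Graph) → Bipartite B →
    (cu cf : ℕ) → IsCu 𝒢 B cu → IsCf 𝒢 B cf → cu ≤ cf * cf
lemma14 _ hereditary _ _ bipartite _ cf (_ , cu-least) (cover , _) =
  cu-least (cf * cf) (ColourSplit.globalInjCover bipartite cover hereditary)
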